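{- Let $G$ be a plane graph with a face $f$ that has a facial walk $v_1v_2\dots v_rv_1$ of length $r\ge3$, and let $G'$ be the plane graph obtained from $G$ by attaching a web to $f$. Then: (i) for any two vertices $u,v\in V(G)$, ${\bf dist}_{G'}(u,v)={\bf dist}_G(u,v)$, and moreover no shortest $(u,v)$-path in $G'$ contains an inner vertex of the attached copy of $W_r(v_1,\dots,v_r)$; (ii) for every vertex $v$ of the attached copy of $W_r(v_1,\dots,v_r)$ there is a vertex $u\in V(G)$ with ${\bf dist}_{G'}(u,v)\le r$.
   Context: ${\bf dist}$ denotes shortest-path distance (number of edges). For $r\ge3$ the graph $W_r(v_1,\dots,v_r)$ is built as follows: take vertices $v_1,\dots,v_r$ and a vertex $u$; for each $i\in\{1,\dots,r\}$ add a path $x_0^i x_1^i\dots x_r^i$ of length $r$ with $x_0^i=v_i$ and $x_r^i=u$; for each $j\in\{1,\dots,r-1\}$ add the cycle $x_j^1x_j^2\dots x_j^rx_j^1$; for each $i\in\{1,\dots,r\}$ and $j\in\{1,\dots,r-1\}$ add the edge $\{x_{j-1}^{i-1},x_j^i\}$, where indices are read with $x_j^0=x_j^r$. The inner vertices of the gadget are those other than $v_1,\dots,v_r$. Attaching a web to a face $f$ of a plane graph with facial walk $v_1\dots v_rv_1$ (vertices may repeat along the walk) means adding a copy of $W_r(v_1,\dots,v_r)$ whose vertices $v_1,\dots,v_r$ are identified with the corresponding vertices of the facial walk, with the rest of the gadget drawn inside $f$ (the cycles drawn concentrically around $u$) so that the result is a plane graph. -}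

module Defs where

open import Data.Nat using (ℕ; zero; suc; _<_; _≤_; pred; _<?_)
open import Data.Fin using (Fin; toℕ; fromℕ<)
open import Data.Sum using (_⊎_; inj₁; inj₂)
open import Data.Product using (Σ; _×_; ∃; _,_)
open import Data.List using (List; []; _∷_)
open import Data.List.Relation.Unary.All using (All)
open import Relation.Nullary using (¬_; yes; no)
open import Relation.Binary.PropositionalEquality using (_≡_)

record Graph (n : ℕ) : Set₁ where
  field
    Adj    : Fin n → Fin n → Set
    sym    : ∀ {x y} → Adj x y → Adj y x
    irrefl : ∀ {x} → ¬ Adj x x

data Walk {X : Set} (E : X → X → Set) : X → X → ℕ → Set where
  nil  : ∀ {x} → Walk E x x 0
  cons : ∀ {x y z d} → E x y → Walk E y z d → Walk E x z (suc d)

verts : ∀ {X : Set} {E : X → X → Set} {x y d} → Walk E x y d → List X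
verts {x = x} nil = x ∷ []
verts {x = x} (cons _ w) = x ∷ verts w

-- dist_E(x , y) = d : there is a walk of length d and none shorter.
-- (If x and y are disconnected, Dist E x y d holds for no d.)
Dist : ∀ {X : Set} (E : X → X → Set) → X → X → ℕ → Set
Dist E x y d = Walk E x y d × (∀ m → m < d → ¬ Walk E x y m)

-- Cyclic successor on indices 0..r-1 (index k stands for v_{k+1}):
-- i' is the successor of i, read modulo r.
CycSucc : (r : ℕ) → Fin r → Fin r → Set
CycSucc r i i' = (suc (toℕ i) ≡ toℕ i') ⊎ ((suc (toℕ i) ≡ r) × (toℕ i' ≡ 0))

-- Inner vertices of W_r: the centre u (hub) and x^i_j for 1 ≤ j ≤ r-1,
-- where  x i k  stands for  x^{i}_{k+1}.
data Inner (r : ℕ) : Set where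
  hub : Inner r
  x   : Fin r → Fin (pred r) → Inner r

module Attach (n r : ℕ) (G : Graph n) (v : Fin r → Fin n) where

  V' : Set
  V' = Fin n ⊎ Inner r

  -- pos i j  is the vertex x^i_j of the gadget (x^i_0 = v_i, x^i_r = u).
  pos : Fin r → ℕ → V'
  pos i zero = inj₁ (v i)
  pos i (suc j) with j <? pred r
  ... | yes p = inj₂ (x i (fromℕ< p))
  ... | no _  = inj₂ hub

  data WebEdge : V' → V' → Set where
    path : ∀ {a b} (i : Fin r) (j : ℕ) → j < r →
           a ≡ pos i j → b ≡ pos i (suc j) → WebEdge a b
    cyc  : ∀ {a b} (i i' : Fin r) (j : ℕ) → 1 ≤ j → j < r → CycSucc r i i' →
           a ≡ pos i j → b ≡ pos i' j → WebEdge a b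
    -- the edges {x^{i-1}_{j-1}, x^i_j}, 1 ≤ j ≤ r-1 (here i' = i+1, j = k+1)
    diag : ∀ {a b} (i i' : Fin r) (k : ℕ) → suc k < r → CycSucc r i i' →
           a ≡ pos i k → b ≡ pos i' (suc k) → WebEdge a b

  BaseEdge : V' → V' → Set
  BaseEdge a b = Σ (Fin n) λ p → Σ (Fin n) λ q →
                 (a ≡ inj₁ p) × (b ≡ inj₁ q) × Graph.Adj G p q

  Adj' : V' → V' → Set
  Adj' a b = BaseEdge a b ⊎ WebEdge a b ⊎ WebEdge b a

  IsBase : V' → Set
  IsBase a = Σ (Fin n) λ p → a ≡ inj₁ p

  InCopy : V' → Set
  InCopy a = (Σ (Fin r) λ i → a ≡ inj₁ (v i)) ⊎ (Σ (Inner r) λ b → a ≡ inj₂ b)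

  AvoidsInner : ∀ {a b d} → Walk Adj' a b d → Set
  AvoidsInner w = All IsBase (verts w)

module Submission where

-- Inside the web, the vertex x^i_j (level j, column i) can be
-- left towards the boundary only by paying for its level: a walk of L web
-- steps from x^i_j down to v_k forces v_k to lie t steps AHEAD of v_i on the
-- facial walk with t + j ≤ L, or t+1 steps BEHIND with t + 2 ≤ L + j
-- ('FaceCost').  This invariant survives every web edge, read backwards
-- along the walk (lemmas 'vertical', 'forward', 'backward', 'hubCost').
-- Consequently an excursion from v_i into the web and back to v_k can be
-- replaced by a strictly shorter walk along the facial walk of G.
--
-- The argument only needs r ≥ 2.

open import Defs
open import Data.Nat using (ℕ; zero; suc; _+_; _∸_; _≤_; _<_; z≤n; s≤s; pred; _<?_)
open import Data.Nat.Properties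
open import Data.Fin using (Fin; toℕ; fromℕ<) renaming (zero to fzero)
open import Data.Fin.Properties using (toℕ-injective; toℕ<n; toℕ-fromℕ<; fromℕ<-toℕ)
open import Data.Sum using (_⊎_; inj₁; inj₂)
open import Data.Product using (Σ; _×_; _,_)
open import Data.List using ([]; _∷_; map)
open import Data.List.Relation.Unary.All as All using (All; []; _∷_)
open import Data.List.Relation.Unary.All.Properties using (map⁻)
open import Data.Empty using (⊥-elim)
open import Relation.Nullary using (¬_; yes; no)
open import Relation.Binary.PropositionalEquality
open import Function.Bundles using (_⇔_; mk⇔)

module _ {X : Set} {E : X → X → Set} where

  snocʷ : ∀ {a b c d} → Walk E a b d → E b c → Walk E a c (suc d)
  snocʷ nil e = cons e nil
  snocʷ (cons e' p) e = cons e' (snocʷ p e)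

  _++ʷ_ : ∀ {a b c d₁ d₂} → Walk E a b d₁ → Walk E b c d₂ → Walk E a c (d₁ + d₂)
  nil ++ʷ q = q
  cons e p ++ʷ q = cons e (p ++ʷ q)

  reverseʷ : (∀ {a b} → E a b → E b a) → ∀ {a b d} → Walk E a b d → Walk E b a d
  reverseʷ sym nil = nil
  reverseʷ sym (cons e p) = snocʷ (reverseʷ sym p) (sym e)

module _ {X Y : Set} {E : X → X → Set} {F : Y → Y → Set}
         (f : X → Y) (g : ∀ {a b} → E a b → F (f a) (f b)) where

  mapʷ : ∀ {a b d} → Walk E a b d → Walk F (f a) (f b) d
  mapʷ nil = nil
  mapʷ (cons e p) = cons (g e) (mapʷ p)

  verts-mapʷ : ∀ {a b d} (p : Walk E a b d) → verts (mapʷ p) ≡ map f (verts p)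
  verts-mapʷ nil = refl
  verts-mapʷ (cons e p) = cong (f _ ∷_) (verts-mapʷ p)

module FaceChain (r' : ℕ) where

  r : ℕ
  r = suc r'

  data Chain : Fin r → Fin r → ℕ → Set where
    here : ∀ {i} → Chain i i 0
    step : ∀ {i i' k t} → CycSucc r i i' → Chain i' k t → Chain i k (suc t)

  Link : Fin r → Fin r → ℕ → Set
  Link i k t = Chain i k t ⊎ Chain k i t

  _▷_ : ∀ {i k k' t} → Chain i k t → CycSucc r k k' → Chain i k' (suc t)
  here ▷ s = step s here
  step s' c ▷ s = step s' (c ▷ s)

  _++ᶜ_ : ∀ {i k l t₁ t₂} → Chain i k t₁ → Chain k l t₂ → Chain i l (t₁ + t₂)
  here ++ᶜ c = c
  step s c ++ᶜ c' = step s (c ++ᶜ c')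

  unsnoc : ∀ {i k t} → Chain i k (suc t) → Σ (Fin r) λ p → Chain i p t × CycSucc r p k
  unsnoc (step s here) = _ , here , s
  unsnoc (step s c@(step _ _)) with unsnoc c
  ... | p , c' , s' = p , step s c' , s'

  succ-unique : ∀ {i a b} → CycSucc r i a → CycSucc r i b → a ≡ b
  succ-unique (inj₁ e) (inj₁ e') = toℕ-injective (trans (sym e) e')
  succ-unique {a = a} (inj₁ e) (inj₂ (e₁ , _)) = ⊥-elim (<-irrefl (trans (sym e) e₁) (toℕ<n a))
  succ-unique {b = b} (inj₂ (e₁ , _)) (inj₁ e) = ⊥-elim (<-irrefl (trans (sym e) e₁) (toℕ<n b))
  succ-unique (inj₂ (_ , e)) (inj₂ (_ , e')) = toℕ-injective (trans e (sym e'))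

  pred-unique : ∀ {a b k} → CycSucc r a k → CycSucc r b k → a ≡ b
  pred-unique (inj₁ e) (inj₁ e') = toℕ-injective (suc-injective (trans e (sym e')))
  pred-unique (inj₁ e) (inj₂ (_ , e')) with trans e e'
  ... | ()
  pred-unique (inj₂ (_ , e')) (inj₁ e) with trans e e'
  ... | ()
  pred-unique (inj₂ (e , _)) (inj₂ (e' , _)) = toℕ-injective (suc-injective (trans e (sym e')))

  unsnocAt : ∀ {i i' k t} → CycSucc r i i' → Chain k i' (suc t) → Chain k i t
  unsnocAt s c with unsnoc c
  ... | p , c' , s' with pred-unique s' s
  ...   | refl = c'

  ascend : (a : Fin r) (d : ℕ) → toℕ a + d < r →
           Σ (Fin r) λ b → toℕ b ≡ toℕ a + d × Chain a b d
  ascend a zero _ = a , sym (+-identityʳ _) , here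
  ascend a (suc d) h with ascend a d (≤-<-trans (+-monoʳ-≤ (toℕ a) (n≤1+n d)) h)
  ... | b , eb , c = fromℕ< b+1<r , toℕ-b+1 , c ▷ inj₁ (sym (toℕ-fromℕ< b+1<r))
    where
      b+1≡ : suc (toℕ b) ≡ toℕ a + suc d
      b+1≡ = trans (cong suc eb) (sym (+-suc (toℕ a) d))
      b+1<r : suc (toℕ b) < r
      b+1<r = subst (_< r) (sym b+1≡) h
      toℕ-b+1 : toℕ (fromℕ< b+1<r) ≡ toℕ a + suc d
      toℕ-b+1 = trans (toℕ-fromℕ< b+1<r) b+1≡

  to-last : (k : Fin r) → toℕ k + (r' ∸ toℕ k) ≡ r'
  to-last k = m+[n∸m]≡n (≤-pred (toℕ<n k))

  -- Any index is reachable from any other by a nonempty chain of fewer than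
  -- 2r steps: climb to the last index, wrap around to the first, climb again.
  wrapChain : (k i : Fin r) → Σ ℕ λ t → Chain k i (suc t) × t + 2 ≤ r + r
  wrapChain k i with ascend k (r' ∸ toℕ k) (≤-reflexive (cong suc (to-last k)))
                   | ascend fzero (toℕ i) (toℕ<n i)
  ... | b , eb , up₁ | i' , ei' , up₂ with toℕ-injective ei'
  ...   | refl = r' ∸ toℕ k + toℕ i , chain , bound
    where
      wrap : CycSucc r b fzero
      wrap = inj₂ (cong suc (trans eb (to-last k)) , refl)
      chain : Chain k i' (suc (r' ∸ toℕ k + toℕ i))
      chain = subst (Chain k i') (+-suc (r' ∸ toℕ k) (toℕ i)) (up₁ ++ᶜ step wrap up₂)
      bound : r' ∸ toℕ k + toℕ i + 2 ≤ r + r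
      bound = ≤-trans (+-monoˡ-≤ 2 (+-mono-≤ (m∸n≤m r' (toℕ k)) (≤-pred (toℕ<n i))))
                      (≤-reflexive (trans (+-comm (r' + r') 2) (cong suc (sym (+-suc r' r')))))

  -- FaceCost i k L j: reaching v_k from x^i_j with L web steps is consistent
  -- with v_k lying t steps ahead of v_i (t + j ≤ L) or t+1 steps behind it
  -- (t + 2 ≤ L + j).
  data FaceCost (i k : Fin r) (L j : ℕ) : Set where
    ahead  : ∀ {t} → Chain i k t → t + j ≤ L → FaceCost i k L j
    behind : ∀ {t} → Chain k i (suc t) → t + 2 ≤ L + j → FaceCost i k L j

  -- FaceCost survives prefixing the walk by one more web step from x^i_j
  -- to x^{i'}_{j'}.  A step within column i changing the level by ≤ 1:
  vertical : ∀ {i k L j j'} → j ≤ suc j' → j' ≤ suc j →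
             FaceCost i k L j' → FaceCost i k (suc L) j
  vertical {L = L} {j} {j'} j≤ _ (ahead {t} c h) = ahead c (begin
    t + j        ≤⟨ +-monoʳ-≤ t j≤ ⟩
    t + suc j'   ≡⟨ +-suc t j' ⟩
    suc (t + j') ≤⟨ s≤s h ⟩
    suc L        ∎)
    where open ≤-Reasoning
  vertical {L = L} {j} {j'} _ j'≤ (behind {t} c h) = behind c (begin
    t + 2        ≤⟨ h ⟩
    L + j'       ≤⟨ +-monoʳ-≤ L j'≤ ⟩
    L + suc j    ≡⟨ +-suc L j ⟩
    suc L + j    ∎)
    where open ≤-Reasoning

  -- A step from column i to its successor column i', not going down:
  forward : ∀ {i i' k L j j'} → CycSucc r i i' → j ≤ j' → j' ≤ suc j → j' ≤ L →
            FaceCost i' k L j' → FaceCost i k (suc L) j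
  forward s j≤j' _ _ (ahead {t} c h) =
    ahead (step s c) (s≤s (≤-trans (+-monoʳ-≤ t j≤j') h))
  forward {L = L} s j≤j' _ j'≤L (behind {zero} c _) with unsnocAt s c
  ... | here = ahead here (≤-trans j≤j' (≤-trans j'≤L (n≤1+n L)))
  forward {L = L} {j} {j'} s _ j'≤ _ (behind {suc t} c h) =
    behind (unsnocAt s c) (≤-trans (≤-pred (begin
      suc t + 2    ≤⟨ h ⟩
      L + j'       ≤⟨ +-monoʳ-≤ L j'≤ ⟩
      L + suc j    ≡⟨ +-suc L j ⟩
      suc (L + j)  ∎)) (n≤1+n (L + j)))
    where open ≤-Reasoning

  -- A step from column i to its predecessor column i₀, not going up:
  backward : ∀ {i₀ i k L j j'} → CycSucc r i₀ i → j' ≤ j → j ≤ suc j' → 1 ≤ j →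
             FaceCost i₀ k L j' → FaceCost i k (suc L) j
  backward {L = L} {j} s _ _ 1≤j (ahead here _) =
    behind (step s here) (s≤s (≤-trans 1≤j (m≤n+m j L)))
  backward {L = L} {j} {j'} s _ j≤ _ (ahead (step {t = t} s' c) h) with succ-unique s' s
  ... | refl = ahead c (begin
    t + j          ≤⟨ +-monoʳ-≤ t j≤ ⟩
    t + suc j'     ≡⟨ +-suc t j' ⟩
    suc t + j'     ≤⟨ h ⟩
    L              ≤⟨ n≤1+n L ⟩
    suc L          ∎)
    where open ≤-Reasoning
  backward {L = L} s j'≤j _ _ (behind c h) =
    behind (c ▷ s) (s≤s (≤-trans h (+-monoʳ-≤ L j'≤j)))

  -- One level below the hub, every boundary index is affordable with r+1
  -- web steps (go through the hub and down any column).
  hubCost : ∀ {i k j} → suc j ≡ r → FaceCost i k (suc r) j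
  hubCost {i} {k} {j} e with wrapChain k i
  ... | t , c , bound =
    behind c (≤-trans bound (≤-reflexive (trans (cong (r +_) (sym e)) (+-suc r j))))

  cancel-one : ∀ t L → t + 2 ≤ L + 1 → suc t ≤ L
  cancel-one t L h = +-cancelʳ-≤ 1 (suc t) L (≤-trans (≤-reflexive (sym (+-suc t 1))) h)

  -- Entering the web at x^i_1 from v_i (resp. from v_{i₀}, i₀ the
  -- predecessor of i) and leaving at v_k after L web steps: then v_k is
  -- joined to the entry vertex along the face by at most L steps.
  straightEntry : ∀ {i k L} → FaceCost i k L 1 → Σ ℕ λ t → Link i k t × t ≤ L
  straightEntry (ahead {t} c h) = t , inj₁ c , ≤-trans (m≤m+n t 1) h
  straightEntry {L = L} (behind {t} c h) = suc t , inj₂ c , cancel-one t L h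

  slantEntry : ∀ {i₀ i k L} → CycSucc r i₀ i → FaceCost i k L 1 →
               Σ ℕ λ t → Link i₀ k t × t ≤ L
  slantEntry {L = L} s (ahead {t} c h) = suc t , inj₁ (step s c) , subst (_≤ L) (+-comm t 1) h
  slantEntry {L = L} s (behind {t} c h) =
    t , inj₂ (unsnocAt s c) , ≤-trans (n≤1+n t) (cancel-one t L h)

module Web (n m : ℕ) (G : Graph n) (v : Fin (suc (suc m)) → Fin n) where
  open FaceChain (suc m)
  open Attach n r G v

  GA : Fin n → Fin n → Set
  GA = Graph.Adj G

  -- Coarse location of a vertex of G': a vertex of G, the vertex x^i_{k+1}
  -- of the web ('level i k'), or the hub.
  data Loc : Set where
    base  : Fin n → Loc
    level : Fin r → ℕ → Loc
    top   : Loc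

  loc : V' → Loc
  loc (inj₁ u) = base u
  loc (inj₂ hub) = top
  loc (inj₂ (x i q)) = level i (toℕ q)

  pos-inner : ∀ i (q : Fin (pred r)) → pos i (suc (toℕ q)) ≡ inj₂ (x i q)
  pos-inner i q with toℕ q <? pred r
  ... | yes p = cong (λ q' → inj₂ (x i q')) (fromℕ<-toℕ q p)
  ... | no ¬p = ⊥-elim (¬p (toℕ<n q))

  pos-top : ∀ i → pos i r ≡ inj₂ hub
  pos-top i with suc m <? suc m
  ... | yes p = ⊥-elim (<-irrefl refl p)
  ... | no _ = refl

  loc-inner : ∀ i k → suc k < r → loc (pos i (suc k)) ≡ level i k
  loc-inner i k h = begin
    loc (pos i (suc k))         ≡⟨ cong (λ j → loc (pos i (suc j))) (sym (toℕ-fromℕ< k<)) ⟩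
    loc (pos i (suc (toℕ q)))   ≡⟨ cong loc (pos-inner i q) ⟩
    level i (toℕ q)             ≡⟨ cong (level i) (toℕ-fromℕ< k<) ⟩
    level i k                   ∎
    where
      open ≡-Reasoning
      k< : k < pred r
      k< = ≤-pred h
      q : Fin (pred r)
      q = fromℕ< k<

  loc-top : ∀ i j → j ≡ r → loc (pos i j) ≡ top
  loc-top i j refl = cong loc (pos-top i)

  -- The edges of the web, one orientation each, as moves between locations:
  -- v_i x^i_1 and v_i x^{i+1}_1, x^i_j x^i_{j+1}, x^i_{r-1} u, x^i_j x^{i+1}_j
  -- and x^i_j x^{i+1}_{j+1}.
  data WebStep : Loc → Loc → Set where
    enter      : ∀ i → WebStep (base (v i)) (level i 0)
    enterSlant : ∀ {i i'} → CycSucc r i i' → WebStep (base (v i)) (level i' 0)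
    rise       : ∀ {i k} → WebStep (level i k) (level i (suc k))
    summit     : ∀ {i k} → suc (suc k) ≡ r → WebStep (level i k) top
    along      : ∀ {i i' k} → CycSucc r i i' → WebStep (level i k) (level i' k)
    slant      : ∀ {i i' k} → CycSucc r i i' → WebStep (level i k) (level i' (suc k))

  data Move : Loc → Loc → Set where
    ground : ∀ {u u'} → GA u u' → Move (base u) (base u')
    forth  : ∀ {a b} → WebStep a b → Move a b
    back   : ∀ {a b} → WebStep b a → Move a b

  classifyWeb : ∀ {a b} → WebEdge a b → WebStep (loc a) (loc b)
  classifyWeb (path i zero _ refl refl) =
    subst (WebStep _) (sym (loc-inner i 0 (s≤s (s≤s z≤n)))) (enter i)
  classifyWeb (path i (suc k) k+1<r refl refl) with m≤n⇒m<n∨m≡n k+1<r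
  ... | inj₁ k+2<r = subst₂ WebStep (sym (loc-inner i k k+1<r)) (sym (loc-inner i (suc k) k+2<r)) rise
  ... | inj₂ k+2≡r = subst₂ WebStep (sym (loc-inner i k k+1<r)) (sym (loc-top i _ k+2≡r)) (summit k+2≡r)
  classifyWeb (cyc i i' (suc k) _ k+1<r s refl refl) =
    subst₂ WebStep (sym (loc-inner i k k+1<r)) (sym (loc-inner i' k k+1<r)) (along s)
  classifyWeb (diag i i' zero 1<r s refl refl) =
    subst (WebStep _) (sym (loc-inner i' 0 1<r)) (enterSlant s)
  classifyWeb (diag i i' (suc k) k+2<r s refl refl) =
    subst₂ WebStep (sym (loc-inner i k (<-trans (n<1+n _) k+2<r))) (sym (loc-inner i' (suc k) k+2<r))
           (slant s)

  classify : ∀ {a b} → Adj' a b → Move (loc a) (loc b)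
  classify (inj₁ (_ , _ , refl , refl , e)) = ground e
  classify (inj₂ (inj₁ s)) = forth (classifyWeb s)
  classify (inj₂ (inj₂ s)) = back (classifyWeb s)

  lift : ∀ {a b d} → Walk Adj' a b d → Walk Move (loc a) (loc b) d
  lift = mapʷ loc classify

  embed : ∀ {u w d} → Walk GA u w d → Walk Adj' (inj₁ u) (inj₁ w) d
  embed = mapʷ inj₁ (λ e → inj₁ (_ , _ , refl , refl , e))

  IsGround : Loc → Set
  IsGround l = Σ (Fin n) λ u → l ≡ base u

  Grounded : ∀ {a b d} → Walk Move a b d → Set
  Grounded p = All IsGround (verts p)

  ground-loc : ∀ {a} → IsGround (loc a) → IsBase a
  ground-loc {inj₁ u} _ = u , refl
  ground-loc {inj₂ hub} (_ , ())
  ground-loc {inj₂ (x _ _)} (_ , ())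

  grounded⇒avoids : ∀ {a b d} (p : Walk Adj' a b d) → Grounded (lift p) → AvoidsInner p
  grounded⇒avoids p g = All.map ground-loc (map⁻ (subst (All IsGround) (verts-mapʷ loc classify p) g))

  -- Part (ii): x^i_j is reached from v_i by climbing the column.
  climb : ∀ i j → j ≤ r → Walk Adj' (inj₁ (v i)) (pos i j) j
  climb i zero _ = nil
  climb i (suc j) j<r = snocʷ (climb i j (<⇒≤ j<r)) (inj₂ (inj₁ (path i j j<r refl refl)))

  within-r : (a : V') → InCopy a → Σ (Fin n) λ u → Σ ℕ λ d → (d ≤ r) × Walk Adj' (inj₁ u) a d
  within-r _ (inj₁ (i , refl)) = v i , 0 , z≤n , nil
  within-r _ (inj₂ (hub , refl)) =
    v fzero , r , ≤-refl , subst (λ a → Walk Adj' _ a r) (pos-top fzero) (climb fzero r ≤-refl)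
  within-r _ (inj₂ (x i q , refl)) =
    v i , suc (toℕ q) , q<r , subst (λ a → Walk Adj' _ a _) (pos-inner i q) (climb i _ q<r)
    where q<r : suc (toℕ q) ≤ r
          q<r = <⇒≤ (s≤s (toℕ<n q))

  module Excursions (face : ∀ i i' → CycSucc r i i' → GA (v i) (v i')) where

    faceWalk : ∀ {i k t} → Chain i k t → Walk GA (v i) (v k) t
    faceWalk here = nil
    faceWalk (step s c) = cons (face _ _ s) (faceWalk c)

    linkWalk : ∀ {i k t} → Link i k t → Walk GA (v i) (v k) t
    linkWalk (inj₁ c) = faceWalk c
    linkWalk (inj₂ c) = reverseʷ (Graph.sym G) (faceWalk c)

    Shortcut : Fin n → Fin n → ℕ → Set
    Shortcut u w ℓ = Σ ℕ λ d → Walk GA u w d × d < ℓ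

    -- What the rest of a walk to w of length ℓ, currently at x^i_j, tells:
    -- it leaves the web at some v_k after 'web' steps (paid as FaceCost)
    -- and continues by a walk of G of length d.
    record Reach (i : Fin r) (j : ℕ) (w : Fin n) (ℓ : ℕ) : Set where
      field
        k      : Fin r
        web d  : ℕ
        low    : j ≤ web
        cost   : FaceCost i k web j
        tail   : Walk GA (v k) w d
        budget : web + d ≤ ℓ

    -- From the hub, at least r web steps are needed to leave the web.
    record HubReach (w : Fin n) (ℓ : ℕ) : Set where
      field
        k      : Fin r
        d      : ℕ
        tail   : Walk GA (v k) w d
        budget : r + d ≤ ℓ

    Summary : ∀ {a w ℓ} → Walk Move a (base w) ℓ → Set
    Summary {base u} {w} {ℓ} p = Shortcut u w ℓ ⊎ (Walk GA u w ℓ × Grounded p)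
    Summary {level i k} {w} {ℓ} _ = Reach i (suc k) w ℓ
    Summary {top} {w} {ℓ} _ = HubReach w ℓ

    projectSummary : ∀ {u w ℓ} {B : Set} → Shortcut u w ℓ ⊎ (Walk GA u w ℓ × B) →
                     Σ ℕ λ d → Walk GA u w d × d ≤ ℓ
    projectSummary (inj₁ (d , q , lt)) = d , q , <⇒≤ lt
    projectSummary {ℓ = ℓ} (inj₂ (q , _)) = ℓ , q , ≤-refl

    extend : ∀ {i i' j j' w ℓ} → j ≤ suc j' →
             (∀ {k L} → j' ≤ L → FaceCost i' k L j' → FaceCost i k (suc L) j) →
             Reach i' j' w ℓ → Reach i j w (suc ℓ)
    extend j≤ update R = record
      { k = k ; web = suc web ; d = d ; low = ≤-trans j≤ (s≤s low)
      ; cost = update low cost ; tail = tail ; budget = s≤s budget }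
      where open Reach R

    -- An excursion through the web is never shortest.
    detour : ∀ {i k web d w ℓ} → (Σ ℕ λ t → Link i k t × t ≤ web) →
             Walk GA (v k) w d → web + d ≤ ℓ → Shortcut (v i) w (suc ℓ)
    detour {d = d} (t , l , t≤web) tail budget =
      t + d , linkWalk l ++ʷ tail , s≤s (≤-trans (+-monoˡ-≤ d t≤web) budget)

    exitAt : ∀ {i k w ℓ} → FaceCost i k 1 1 → Σ ℕ (λ d → Walk GA (v k) w d × d ≤ ℓ) →
             Reach i 1 w (suc ℓ)
    exitAt c (d , q , d≤ℓ) =
      record { k = _ ; web = 1 ; d = d ; low = ≤-refl ; cost = c ; tail = q ; budget = s≤s d≤ℓ }

    intoHub : ∀ {i j w ℓ} → suc j ≡ r → HubReach w ℓ → Reach i j w (suc ℓ)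
    intoHub e R = record
      { k = k ; web = suc r ; d = d ; low = ≤-trans (n≤1+n _) (≤-trans (≤-reflexive e) (n≤1+n r))
      ; cost = hubCost e ; tail = tail ; budget = s≤s budget }
      where open HubReach R

    outOfHub : ∀ {i j w ℓ} → suc j ≡ r → Reach i j w ℓ → HubReach w (suc ℓ)
    outOfHub e R = record
      { k = k ; d = d ; tail = tail
      ; budget = ≤-trans (+-monoˡ-≤ d (≤-trans (≤-reflexive (sym e)) (s≤s low))) (s≤s budget) }
      where open Reach R

    n≤2+n : ∀ j → j ≤ suc (suc j)
    n≤2+n j = m≤n⇒m≤1+n (n≤1+n j)

    analyse : ∀ {a w ℓ} (p : Walk Move a (base w) ℓ) → Summary p
    analyse nil = inj₂ (nil , (_ , refl) ∷ [])
    analyse (cons (ground e) p) with analyse p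
    ... | inj₁ (d , q , lt) = inj₁ (suc d , cons e q , s≤s lt)
    ... | inj₂ (q , g) = inj₂ (cons e q , (_ , refl) ∷ g)
    analyse (cons (forth (enter _)) p) =
      inj₁ (detour (straightEntry cost) tail budget)
      where open Reach (analyse p)
    analyse (cons (forth (enterSlant s)) p) =
      inj₁ (detour (slantEntry s cost) tail budget)
      where open Reach (analyse p)
    analyse (cons (back (enter _)) p) = exitAt (ahead here ≤-refl) (projectSummary (analyse p))
    analyse (cons (back (enterSlant s)) p) =
      exitAt (behind (step s here) ≤-refl) (projectSummary (analyse p))
    analyse (cons (forth (rise {k = k})) p) =
      extend (n≤2+n (suc k)) (λ _ → vertical (n≤2+n (suc k)) ≤-refl) (analyse p)
    analyse (cons (back (rise {k = k})) p) =
      extend ≤-refl (λ _ → vertical ≤-refl (n≤2+n (suc k))) (analyse p)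
    analyse (cons (forth (along s)) p) = extend (n≤1+n _) (forward s ≤-refl (n≤1+n _)) (analyse p)
    analyse (cons (forth (slant {k = k} s)) p) =
      extend (n≤2+n (suc k)) (forward s (n≤1+n _) ≤-refl) (analyse p)
    analyse (cons (back (along s)) p) =
      extend (n≤1+n _) (λ _ → backward s ≤-refl (n≤1+n _) (s≤s z≤n)) (analyse p)
    analyse (cons (back (slant s)) p) =
      extend ≤-refl (λ _ → backward s (n≤1+n _) ≤-refl (s≤s z≤n)) (analyse p)
    analyse (cons (forth (summit e)) p) = intoHub e (analyse p)
    analyse (cons (back (summit e)) p) = outOfHub e (analyse p)

    no-shortcut : ∀ {u w d} → Dist Adj' (inj₁ u) (inj₁ w) d → ¬ Shortcut u w d
    no-shortcut (_ , minimal) (d' , q , d'<d) = minimal d' d'<d (embed q)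

    distance-preserved : (u w : Fin n) (d : ℕ) → Dist GA u w d ⇔ Dist Adj' (inj₁ u) (inj₁ w) d
    distance-preserved u w d = mk⇔ to from
      where
        to : Dist GA u w d → Dist Adj' (inj₁ u) (inj₁ w) d
        to (q , minimal) = embed q , λ k k<d p → shorter k<d (projectSummary (analyse (lift p)))
          where shorter : ∀ {k} → k < d → ¬ Σ ℕ (λ d' → Walk GA u w d' × d' ≤ k)
                shorter k<d (d' , q' , d'≤k) = minimal d' (≤-<-trans d'≤k k<d) q'
        from : Dist Adj' (inj₁ u) (inj₁ w) d → Dist GA u w d
        from D@(p , minimal) with analyse (lift p)
        ... | inj₁ cut = ⊥-elim (no-shortcut D cut)
        ... | inj₂ (q , _) = q , λ k k<d q' → minimal k k<d (embed q')

    shortest-avoids : (u w : Fin n) (d : ℕ) (p : Walk Adj' (inj₁ u) (inj₁ w) d) →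
                      Dist Adj' (inj₁ u) (inj₁ w) d → AvoidsInner p
    shortest-avoids u w d p D with analyse (lift p)
    ... | inj₁ cut = ⊥-elim (no-shortcut D cut)
    ... | inj₂ (_ , g) = grounded⇒avoids p g

lemma8 : (n r : ℕ) (G : Graph n) (v : Fin r → Fin n) →
    3 ≤ r →
    (∀ i i' → CycSucc r i i' → Graph.Adj G (v i) (v i')) →
    ((u w : Fin n) (d : ℕ) →
        Dist (Graph.Adj G) u w d ⇔ Dist (Attach.Adj' n r G v) (inj₁ u) (inj₁ w) d)
    × ((u w : Fin n) (d : ℕ) (p : Walk (Attach.Adj' n r G v) (inj₁ u) (inj₁ w) d) →
        Dist (Attach.Adj' n r G v) (inj₁ u) (inj₁ w) d → Attach.AvoidsInner n r G v p)
    × ((a : Attach.V' n r G v) → Attach.InCopy n r G v a →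
        Σ (Fin n) λ u → Σ ℕ λ d → (d ≤ r) × Walk (Attach.Adj' n r G v) (inj₁ u) a d)
lemma8 n (suc (suc m)) G v (s≤s (s≤s _)) face =
  distance-preserved , shortest-avoids , within-r
  where
    open Web n m G v
    open Excursions face
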